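{- Let $p$ be a prime, $\ell\ge1$, and let $[c]$ be a non-zero constant sequence in $P_{p^\ell}$ with $\nu_p(c)=t$. Let $s\in\mathbb{N}$ have base-$p$ expansion $s=\lfloor a_ka_{k-1}\cdots a_0\rfloor_p$ with $a_k\ne0$. Then $$\nu_p\Big(\sum_{n=0}^{p^{\ell-t+k}-1}\Sigma^s[c](n)\Big)=\begin{cases}\ell-1&\text{if }a_k=a_{k-1}=\cdots=a_0=p-1,\\ \ge\ell&\text{otherwise.}\end{cases}$$
   Context: $P_{p^\ell}$ is the module of periodic sequences $\mathbb{N}\to\mathbb{Z}_{p^\ell}$, and $[c]$ is the constant sequence with value $c$. $\Sigma$ is the sum operator $\Sigma f(0)=0$, $\Sigma f(n)=f(n-1)+\Sigma f(n-1)$. On $\mathbb{Z}_{p^\ell}$, $\nu_p$ is the $p$-adic valuation of any representative of a non-zero class (a value in $\{0,\dots,\ell-1\}$), with $\nu_p(0)=\infty$. The notation $\lfloor a_k\cdots a_0\rfloor_p$ means $\sum_i a_ip^i$ with digits $0\le a_i<p$. -}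

module Defs where

open import Data.Nat using (ℕ; zero; suc; _+_; _*_; _^_; _%_)
open import Data.Nat.Divisibility using (_∣_)
open import Data.Fin using (Fin; toℕ)
open import Data.Product using (_×_)
open import Relation.Nullary using (¬_)

-- Reduction of a natural number to its canonical representative in ℤ_m
-- (for m ≥ 1; the m = 0 clause is never used).
reduce : ℕ → ℕ → ℕ
reduce zero    x = x
reduce (suc m) x = x % suc m

-- Sequences ℕ → ℤ_m are represented by ℕ-valued functions whose values are
-- canonical representatives in {0,…,m-1}.
Seq : Set
Seq = ℕ → ℕ

const : ℕ → Seq
const c _ = c

Σop : ℕ → Seq → Seq
Σop m f zero    = 0
Σop m f (suc n) = reduce m (f n + Σop m f n)

Σpow : ℕ → ℕ → Seq → Seq
Σpow m zero    f = f
Σpow m (suc s) f = Σop m (Σpow m s f)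

sumTo : ℕ → Seq → ℕ → ℕ
sumTo m f zero    = 0
sumTo m f (suc N) = reduce m (sumTo m f N + f N)

-- Value of a digit string: fromDigits p k a = ∑_{i<k} a_i p^i.
fromDigits : (p k : ℕ) → (Fin k → ℕ) → ℕ
fromDigits p k a = go k a
  where
  go : (j : ℕ) → (Fin j → ℕ) → ℕ
  go zero    a = 0
  go (suc j) a = a Fin.zero + p * go j (λ i → a (Fin.suc i))
    where import Data.Fin as Fin

HasVal : (p x t : ℕ) → Set
HasVal p x t = (p ^ t ∣ x) × ¬ (p ^ suc t ∣ x)

-- Σ^s[c](n) = c·C(n,s), so the sum in question is Σ^{s+1}[c](N) = c·C(N,s+1) with
-- N = p^(ℓ-t+k).  By absorption, (s+1)·C(N,s+1) = N·C(N-1,s).  If some digit of s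
-- is not p-1 then s+1 < p^(k+1), so ν_p(s+1) ≤ k and p^(ℓ-t) divides C(N,s+1),
-- making the sum vanish modulo p^ℓ.  If all digits are p-1 then s+1 = p^(k+1),
-- whence C(N,s+1) = p^(ℓ-t-1)·C(N-1,s), and C(p^e-1,i) is prime to p (Pascal's
-- rule plus absorption, by induction on i); the sum then has valuation exactly ℓ-1.
module Submission where

open import Defs
open import Data.Nat using (ℕ; zero; suc; _+_; _*_; _^_; _∸_; _<_; _≤_)
open import Data.Nat.Primality using (Prime)
open import Data.Fin using (Fin; fromℕ)
open import Data.Product using (_×_)
open import Relation.Binary.PropositionalEquality using (_≡_; _≢_)
open import Relation.Nullary using (¬_)

open import Data.Nat.Base
  using (NonZero; _%_; pred; z≤n; s≤s; s≤s⁻¹; z<s; ≢-nonZero; >-nonZero; >-nonZero⁻¹)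
open import Data.Nat.Properties
open import Data.Nat.Divisibility
open import Data.Nat.DivMod using (m<n⇒m%n≡m; %-distribˡ-+)
open import Data.Nat.Combinatorics using (_C_; nC1≡n; k>n⇒nCk≡0; nCk+nC[k+1]≡[n+1]C[k+1])
open import Data.Nat.Primality using (euclidsLemma; prime⇒nonZero; ¬prime[1])
import Data.Fin as Fin
open import Data.Product using (∃; _,_; proj₁)
open import Data.Sum using (_⊎_; inj₁; inj₂)
open import Function using (_∘_)
open import Algebra.Properties.CommutativeSemigroup *-commutativeSemigroup using (interchange)
open import Relation.Nullary using (yes; no; contradiction)
open import Relation.Binary.PropositionalEquality
  using (refl; sym; trans; cong; cong₂; subst; subst₂; module ≡-Reasoning)

[k+1]*[n+1]C[k+1]≡[n+1]*nCk : ∀ n k → suc k * (suc n C suc k) ≡ suc n * (n C k)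
[k+1]*[n+1]C[k+1]≡[n+1]*nCk zero    zero    = refl
[k+1]*[n+1]C[k+1]≡[n+1]*nCk zero    (suc k) = begin
  suc (suc k) * (1 C suc (suc k)) ≡⟨ cong (suc (suc k) *_) (k>n⇒nCk≡0 {1} {suc (suc k)} (s≤s (s≤s z≤n))) ⟩
  suc (suc k) * 0                 ≡⟨ *-zeroʳ (suc (suc k)) ⟩
  0                               ≡⟨ k>n⇒nCk≡0 {0} {suc k} z<s ⟨
  0 C suc k                       ≡⟨ *-identityˡ (0 C suc k) ⟨
  1 * (0 C suc k)                 ∎
  where open ≡-Reasoning
[k+1]*[n+1]C[k+1]≡[n+1]*nCk (suc n) zero    =
  trans (*-identityˡ _) (trans (nC1≡n (suc (suc n))) (sym (*-identityʳ _)))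
[k+1]*[n+1]C[k+1]≡[n+1]*nCk (suc n) (suc k) = begin
  suc (suc k) * (suc (suc n) C suc (suc k))
    ≡⟨ cong (suc (suc k) *_) (nCk+nC[k+1]≡[n+1]C[k+1] (suc n) (suc k)) ⟨
  suc (suc k) * (X + Y)
    ≡⟨ *-distribˡ-+ (suc (suc k)) X Y ⟩
  (X + suc k * X) + suc (suc k) * Y
    ≡⟨ +-assoc X (suc k * X) _ ⟩
  X + (suc k * X + suc (suc k) * Y)
    ≡⟨ cong (X +_) (cong₂ _+_ ([k+1]*[n+1]C[k+1]≡[n+1]*nCk n k) ([k+1]*[n+1]C[k+1]≡[n+1]*nCk n (suc k))) ⟩
  X + (suc n * (n C k) + suc n * (n C suc k))
    ≡⟨ cong (X +_) (*-distribˡ-+ (suc n) (n C k) (n C suc k)) ⟨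
  X + suc n * (n C k + n C suc k)
    ≡⟨ cong (λ z → X + suc n * z) (nCk+nC[k+1]≡[n+1]C[k+1] n k) ⟩
  X + suc n * X
    ∎
  where
  open ≡-Reasoning
  X = suc n C suc k
  Y = suc n C suc (suc k)

reduce≡% : ∀ m .{{_ : NonZero m}} x → reduce m x ≡ x % m
reduce≡% (suc m) x = refl

Σpow-const : ∀ m .{{_ : NonZero m}} {c} → c < m → ∀ s n → Σpow m s (const c) n ≡ (c * (n C s)) % m
Σpow-const m {c} c<m zero    n       = sym (trans (cong (_% m) (*-identityʳ c)) (m<n⇒m%n≡m c<m))
Σpow-const m {c} c<m (suc s) zero    = begin
  0                       ≡⟨ m<n⇒m%n≡m (>-nonZero⁻¹ m) ⟨
  0 % m                   ≡⟨ cong (_% m) (*-zeroʳ c) ⟨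
  (c * 0) % m             ≡⟨ cong (λ z → (c * z) % m) (k>n⇒nCk≡0 {0} {suc s} z<s) ⟨
  (c * (0 C suc s)) % m   ∎
  where open ≡-Reasoning
Σpow-const m {c} c<m (suc s) (suc n) = begin
  reduce m (Σpow m s (const c) n + Σpow m (suc s) (const c) n)
    ≡⟨ reduce≡% m _ ⟩
  (Σpow m s (const c) n + Σpow m (suc s) (const c) n) % m
    ≡⟨ cong (_% m) (cong₂ _+_ (Σpow-const m c<m s n) (Σpow-const m c<m (suc s) n)) ⟩
  ((c * (n C s)) % m + (c * (n C suc s)) % m) % m
    ≡⟨ %-distribˡ-+ (c * (n C s)) (c * (n C suc s)) m ⟨
  (c * (n C s) + c * (n C suc s)) % m
    ≡⟨ cong (_% m) (*-distribˡ-+ c (n C s) (n C suc s)) ⟨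
  (c * (n C s + n C suc s)) % m
    ≡⟨ cong (λ z → (c * z) % m) (nCk+nC[k+1]≡[n+1]C[k+1] n s) ⟩
  (c * (suc n C suc s)) % m
    ∎
  where open ≡-Reasoning

sumTo≡Σop : ∀ m f N → sumTo m f N ≡ Σop m f N
sumTo≡Σop m f zero    = refl
sumTo≡Σop m f (suc N) =
  cong (reduce m) (trans (cong (_+ f N) (sumTo≡Σop m f N)) (+-comm (Σop m f N) (f N)))

sumTo-Σpow-const : ∀ m .{{_ : NonZero m}} {c} → c < m → ∀ s N →
                   sumTo m (Σpow m s (const c)) N ≡ (c * (N C suc s)) % m
sumTo-Σpow-const m c<m s N = trans (sumTo≡Σop m _ N) (Σpow-const m c<m (suc s) N)

suc-fromDigits-all-max : ∀ {p} .{{_ : NonZero p}} j a → (∀ i → a i ≡ p ∸ 1) →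
                         suc (fromDigits p j a) ≡ p ^ j
suc-fromDigits-all-max         zero    a all-max = refl
suc-fromDigits-all-max {suc q} (suc j) a all-max = begin
  suc (a Fin.zero + suc q * F)  ≡⟨ cong (λ d → suc (d + suc q * F)) (all-max Fin.zero) ⟩
  suc q + suc q * F             ≡⟨ *-suc (suc q) F ⟨
  suc q * suc F                 ≡⟨ cong (suc q *_) (suc-fromDigits-all-max j _ (all-max ∘ Fin.suc)) ⟩
  suc q * suc q ^ j             ∎
  where open ≡-Reasoning
        F = fromDigits (suc q) j (a ∘ Fin.suc)

fromDigits-all-max⊎< : ∀ {p} .{{_ : NonZero p}} j a → (∀ i → a i < p) →
                       (∀ i → a i ≡ p ∸ 1) ⊎ suc (fromDigits p j a) < p ^ j
fromDigits-all-max⊎<         zero    a a<p = inj₁ λ ()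
fromDigits-all-max⊎< {suc q} (suc j) a a<p
  with fromDigits-all-max⊎< j (a ∘ Fin.suc) (a<p ∘ Fin.suc) | a Fin.zero ≟ q
... | inj₂ tail< | _ = inj₂ (begin-strict
  suc (a Fin.zero + suc q * F)  ≤⟨ +-monoˡ-≤ (suc q * F) (a<p Fin.zero) ⟩
  suc q + suc q * F             ≡⟨ *-suc (suc q) F ⟨
  suc q * suc F                 <⟨ *-monoʳ-< (suc q) tail< ⟩
  suc q * suc q ^ j             ∎)
  where open ≤-Reasoning
        F = fromDigits (suc q) j (a ∘ Fin.suc)
... | inj₁ tail-max | yes a₀≡q = inj₁ λ { Fin.zero → a₀≡q ; (Fin.suc i) → tail-max i }
... | inj₁ tail-max | no a₀≢q  = inj₂ (begin-strict
  suc (a Fin.zero + suc q * F)  <⟨ +-monoˡ-< (suc q * F) (s≤s (≤∧≢⇒< (s≤s⁻¹ (a<p Fin.zero)) a₀≢q)) ⟩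
  suc q + suc q * F             ≡⟨ *-suc (suc q) F ⟨
  suc q * suc F                 ≡⟨ cong (suc q *_) (suc-fromDigits-all-max j _ tail-max) ⟩
  suc q * suc q ^ j             ∎)
  where open ≤-Reasoning
        F = fromDigits (suc q) j (a ∘ Fin.suc)

HasVal-% : ∀ {p x v m} .{{_ : NonZero m}} → p ^ suc v ∣ m → HasVal p x v → HasVal p (x % m) v
HasVal-% {p} p^v+1∣m (p^v∣x , p^v+1∤x) =
  %-presˡ-∣ p^v∣x (∣-trans (n∣m*n p) p^v+1∣m) ,
  λ p^v+1∣x%m → p^v+1∤x (∣n∣m%n⇒∣m p^v+1∣m p^v+1∣x%m)

HasVal⇒≢0 : ∀ {p x} v → HasVal p x v → x ≢ 0
HasVal⇒≢0 {p} v (_ , p^v+1∤x) refl = p^v+1∤x ((p ^ suc v) ∣0)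

p^t∣c∧c<p^ℓ⇒t<ℓ : ∀ {p t c ℓ} .{{_ : NonZero p}} .{{_ : NonZero c}} → p ^ t ∣ c → c < p ^ ℓ → t < ℓ
p^t∣c∧c<p^ℓ⇒t<ℓ {p} p^t∣c c<p^ℓ = ≰⇒> λ ℓ≤t → <⇒≱ c<p^ℓ (≤-trans (^-monoʳ-≤ p ℓ≤t) (∣⇒≤ p^t∣c))

module _ {p : ℕ} (isPrime : Prime p) where

  private instance
    p≢0 : NonZero p
    p≢0 = prime⇒nonZero isPrime

  p∤j∧p^f∣j*x⇒p^f∣x : ∀ f {j x} → ¬ p ∣ j → p ^ f ∣ j * x → p ^ f ∣ x
  p∤j∧p^f∣j*x⇒p^f∣x zero    {x = x} _ _ = 1∣ x
  p∤j∧p^f∣j*x⇒p^f∣x (suc f) {j} {x} p∤j p^f+1∣jx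
    with euclidsLemma j x isPrime (∣-trans (m∣m*n (p ^ f)) p^f+1∣jx)
  ... | inj₁ p∣j = contradiction p∣j p∤j
  ... | inj₂ (divides y refl) = subst (p * p ^ f ∣_) (*-comm p y) (*-monoʳ-∣ p p^f∣y)
    where
    jyp≡pjy : j * (y * p) ≡ p * (j * y)
    jyp≡pjy = trans (sym (*-assoc j y p)) (*-comm (j * y) p)
    p^f∣y : p ^ f ∣ y
    p^f∣y = p∤j∧p^f∣j*x⇒p^f∣x f p∤j (*-cancelˡ-∣ p (subst (p * p ^ f ∣_) jyp≡pjy p^f+1∣jx))

  j<p^[1+n]∧p^[n+f]∣j*x⇒p^f∣x : ∀ n f {j x} → 0 < j → j < p ^ suc n →
                                p ^ (n + f) ∣ j * x → p ^ f ∣ x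
  j<p^[1+n]∧p^[n+f]∣j*x⇒p^f∣x zero    f {j} 0<j j<p = p∤j∧p^f∣j*x⇒p^f∣x f p∤j
    where
    p∤j : ¬ p ∣ j
    p∤j p∣j = <⇒≱ (subst (j <_) (*-identityʳ p) j<p) (∣⇒≤ {{>-nonZero 0<j}} p∣j)
  j<p^[1+n]∧p^[n+f]∣j*x⇒p^f∣x (suc n) f {j} {x} 0<j j<p^n+2 p^n+1+f∣jx with p ∣? j
  ... | no p∤j =
    ∣-trans (subst (p ^ f ∣_) (sym (^-distribˡ-+-* p (suc n) f)) (n∣m*n (p ^ suc n)))
            (p∤j∧p^f∣j*x⇒p^f∣x (suc n + f) p∤j p^n+1+f∣jx)
  ... | yes (divides j′ refl) =
    j<p^[1+n]∧p^[n+f]∣j*x⇒p^f∣x n f 0<j′ j′<p^n+1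
      (*-cancelˡ-∣ p (subst (p * p ^ (n + f) ∣_) j′px≡pj′x p^n+1+f∣jx))
    where
    0<j′ : 0 < j′
    0<j′ = n≢0⇒n>0 λ { refl → <⇒≱ 0<j z≤n }
    j′<p^n+1 : j′ < p ^ suc n
    j′<p^n+1 = *-cancelˡ-< p j′ (p ^ suc n) (subst (_< p * p ^ suc n) (*-comm j′ p) j<p^n+2)
    j′px≡pj′x : j′ * p * x ≡ p * (j′ * x)
    j′px≡pj′x = trans (cong (_* x) (*-comm j′ p)) (*-assoc p j′ x)

  p∤u⇒HasVal[u*p^v] : ∀ {u} v → ¬ p ∣ u → HasVal p (u * p ^ v) v
  p∤u⇒HasVal[u*p^v] {u} v p∤u =
    n∣m*n u , λ p^v+1∣ → p∤u (*-cancelʳ-∣ (p ^ v) {{m^n≢0 p v}} p^v+1∣)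

  HasVal⇒≡u*p^v : ∀ {x v} → HasVal p x v → ∃ λ u → x ≡ u * p ^ v × ¬ p ∣ u
  HasVal⇒≡u*p^v {v = v} (divides u refl , p^v+1∤x) =
    u , refl , λ p∣u → p^v+1∤x (*-monoˡ-∣ (p ^ v) p∣u)

  HasVal-* : ∀ {x y v w} → HasVal p x v → HasVal p y w → HasVal p (x * y) (v + w)
  HasVal-* {v = v} {w} hx hy with HasVal⇒≡u*p^v {v = v} hx | HasVal⇒≡u*p^v {v = w} hy
  ... | u , refl , p∤u | u′ , refl , p∤u′ =
    subst (λ z → HasVal p z (v + w)) uu′p^[v+w]≡ (p∤u⇒HasVal[u*p^v] (v + w) p∤uu′)
    where
    p∤uu′ : ¬ p ∣ u * u′
    p∤uu′ p∣uu′ with euclidsLemma u u′ isPrime p∣uu′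
    ... | inj₁ p∣u  = p∤u p∣u
    ... | inj₂ p∣u′ = p∤u′ p∣u′
    uu′p^[v+w]≡ : u * u′ * p ^ (v + w) ≡ u * p ^ v * (u′ * p ^ w)
    uu′p^[v+w]≡ = trans (cong (u * u′ *_) (^-distribˡ-+-* p v w)) (interchange u u′ (p ^ v) (p ^ w))

  -- A special case of Lucas's theorem.
  p∤[p^e∸1]Ci : ∀ e {M} → suc M ≡ p ^ suc e → ∀ i → i ≤ M → ¬ p ∣ M C i
  p∤[p^e∸1]Ci e M+1≡ zero    _   p∣1 = ¬prime[1] (subst Prime (∣1⇒≡1 p∣1) isPrime)
  p∤[p^e∸1]Ci e {M} M+1≡ (suc i) i<M p∣MCi+1 = p∤[p^e∸1]Ci e M+1≡ i (<⇒≤ i<M) p∣MCi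
    where
    p^e+1∣ : p ^ (e + 1) ∣ suc i * (suc M C suc i)
    p^e+1∣ = subst₂ (λ d n → p ^ d ∣ n) (+-comm 1 e) (sym ([k+1]*[n+1]C[k+1]≡[n+1]*nCk M i))
               (subst (_∣ suc M * (M C i)) M+1≡ (m∣m*n (M C i)))
    p∣M+1Ci+1 : p ∣ suc M C suc i
    p∣M+1Ci+1 = subst (_∣ suc M C suc i) (*-identityʳ p)
                  (j<p^[1+n]∧p^[n+f]∣j*x⇒p^f∣x e 1 z<s (subst (suc i <_) M+1≡ (s≤s i<M)) p^e+1∣)
    p∣MCi : p ∣ M C i
    p∣MCi = ∣m+n∣m⇒∣n (subst (p ∣_) (trans (sym (nCk+nC[k+1]≡[n+1]C[k+1] M i)) (+-comm (M C i) _))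
                                     p∣M+1Ci+1)
                      p∣MCi+1

  p^f∣NC[1+s] : ∀ k f {N s} → p ^ (k + f) ∣ N → suc s < p ^ suc k → p ^ f ∣ N C suc s
  p^f∣NC[1+s] k f {zero}  {s} _    _    = subst (p ^ f ∣_) (sym (k>n⇒nCk≡0 {0} {suc s} z<s)) ((p ^ f) ∣0)
  p^f∣NC[1+s] k f {suc M} {s} p^∣N s+1< =
    j<p^[1+n]∧p^[n+f]∣j*x⇒p^f∣x k f z<s s+1<
      (subst (p ^ (k + f) ∣_) (sym ([k+1]*[n+1]C[k+1]≡[n+1]*nCk M s)) (∣m⇒∣m*n (M C s) p^∣N))

  [1+M]C[1+s]≡MCs*p^r : ∀ k r {M s} → suc M ≡ p ^ (suc k + r) → suc s ≡ p ^ suc k →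
                        suc M C suc s ≡ (M C s) * p ^ r
  [1+M]C[1+s]≡MCs*p^r k r {M} {s} M+1≡ s+1≡ = *-cancelˡ-≡ _ _ (p ^ suc k) {{m^n≢0 p (suc k)}} (begin
    p ^ suc k * (suc M C suc s)    ≡⟨ cong (_* (suc M C suc s)) s+1≡ ⟨
    suc s * (suc M C suc s)        ≡⟨ [k+1]*[n+1]C[k+1]≡[n+1]*nCk M s ⟩
    suc M * (M C s)                ≡⟨ cong (_* (M C s)) (trans M+1≡ (^-distribˡ-+-* p (suc k) r)) ⟩
    p ^ suc k * p ^ r * (M C s)    ≡⟨ *-assoc (p ^ suc k) (p ^ r) (M C s) ⟩
    p ^ suc k * (p ^ r * (M C s))  ≡⟨ cong (p ^ suc k *_) (*-comm (p ^ r) (M C s)) ⟩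
    p ^ suc k * ((M C s) * p ^ r)  ∎)
    where open ≡-Reasoning

  HasVal-p^[1+k+r]C[1+s] : ∀ k r {s} → suc s ≡ p ^ suc k → HasVal p (p ^ (suc k + r) C suc s) r
  HasVal-p^[1+k+r]C[1+s] k r {s} s+1≡ =
    subst (λ N → HasVal p (N C suc s) r) (suc-pred N)
      (subst (λ z → HasVal p z r) (sym ([1+M]C[1+s]≡MCs*p^r k r M+1≡ s+1≡))
        (p∤u⇒HasVal[u*p^v] r (p∤[p^e∸1]Ci (k + r) M+1≡ s s≤M)))
    where
    N = p ^ (suc k + r)
    instance
      N≢0 : NonZero N
      N≢0 = m^n≢0 p (suc k + r)
    M+1≡ : suc (pred N) ≡ N
    M+1≡ = suc-pred N
    s≤M : s ≤ pred N
    s≤M = s≤s⁻¹ (subst₂ _≤_ (sym s+1≡) (sym M+1≡) (^-monoʳ-≤ p (s≤s (m≤m+n k r))))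

  p^[1+t+r]∣c*p^[1+k+r]C[1+s] : ∀ {c} t k r {s} → p ^ t ∣ c → suc s < p ^ suc k →
                                p ^ (suc t + r) ∣ c * (p ^ (suc k + r) C suc s)
  p^[1+t+r]∣c*p^[1+k+r]C[1+s] {c} t k r {s} p^t∣c s+1< =
    subst (_∣ c * (p ^ (suc k + r) C suc s)) (trans (sym (^-distribˡ-+-* p t (suc r))) (cong (p ^_) (+-suc t r)))
      (*-pres-∣ p^t∣c (p^f∣NC[1+s] k (suc r) (∣-reflexive (cong (p ^_) (+-suc k r))) s+1<))

lemma3p3 : (p ℓ : ℕ) → Prime p → 1 ≤ ℓ →
    (c : ℕ) → c < p ^ ℓ → c ≢ 0 →
    (t : ℕ) → HasVal p c t →
    (s k : ℕ) → (a : Fin (suc k) → ℕ) → (∀ i → a i < p) → a (fromℕ k) ≢ 0 →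
    s ≡ fromDigits p (suc k) a →
    let S = sumTo (p ^ ℓ) (Σpow (p ^ ℓ) s (const c)) (p ^ (ℓ ∸ t + k))
    in ((∀ i → a i ≡ p ∸ 1) → S ≢ 0 × HasVal p S (ℓ ∸ 1))
    × (¬ (∀ i → a i ≡ p ∸ 1) → S ≡ 0)
lemma3p3 p ℓ isPrime _ c c<p^ℓ c≢0 t c-val s k a a<p _ s≡digits
  with r , refl ← m≤n⇒∃[o]m+o≡n (p^t∣c∧c<p^ℓ⇒t<ℓ {t = t} {ℓ = ℓ} {{prime⇒nonZero isPrime}}
                                                  {{≢-nonZero c≢0}} (proj₁ c-val) c<p^ℓ)
  = all-max , not-all-max
  where
  instance
    p≢0 : NonZero p
    p≢0 = prime⇒nonZero isPrime
    p^ℓ≢0 : NonZero (p ^ (suc t + r))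
    p^ℓ≢0 = m^n≢0 p (suc t + r)
  S = sumTo (p ^ (suc t + r)) (Σpow (p ^ (suc t + r)) s (const c)) (p ^ (suc t + r ∸ t + k))
  S≡ : S ≡ (c * (p ^ (suc k + r) C suc s)) % p ^ (suc t + r)
  S≡ = trans (sumTo-Σpow-const _ c<p^ℓ s (p ^ (suc t + r ∸ t + k)))
             (cong (λ e → (c * (p ^ e C suc s)) % p ^ (suc t + r)) N-exponent)
    where
    N-exponent : suc t + r ∸ t + k ≡ suc k + r
    N-exponent = trans (cong (λ e → e ∸ t + k) (sym (+-suc t r)))
                       (trans (cong (_+ k) (m+n∸m≡n t (suc r))) (cong suc (+-comm r k)))
  all-max : (∀ i → a i ≡ p ∸ 1) → S ≢ 0 × HasVal p S (t + r)
  all-max all = HasVal⇒≢0 (t + r) S-val , S-val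
    where
    s+1≡ : suc s ≡ p ^ suc k
    s+1≡ = trans (cong suc s≡digits) (suc-fromDigits-all-max (suc k) a all)
    S-val : HasVal p S (t + r)
    S-val = subst (λ z → HasVal p z (t + r)) (sym S≡)
              (HasVal-% {v = t + r} ∣-refl
                (HasVal-* isPrime {v = t} {w = r} c-val (HasVal-p^[1+k+r]C[1+s] isPrime k r s+1≡)))
  not-all-max : ¬ (∀ i → a i ≡ p ∸ 1) → S ≡ 0
  not-all-max ¬all with fromDigits-all-max⊎< (suc k) a a<p
  ... | inj₁ all = contradiction all ¬all
  ... | inj₂ s+1< = trans S≡ (n∣m⇒m%n≡0 _ _
          (p^[1+t+r]∣c*p^[1+k+r]C[1+s] isPrime t k r (proj₁ c-val)
            (subst (λ z → suc z < p ^ suc k) (sym s≡digits) s+1<)))
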